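{- Let $X$ be a coverable vertex parameter, let $G$ be a graph, and let $v\in V(G)$. If $X(G)=X(G-v)+1$, then $\mathcal{TE}_X(G-v)$ is isomorphic to a subgraph of $\mathcal{TE}_X(G)$ and $\mathcal{TS}_X(G-v)$ is isomorphic to a subgraph of $\mathcal{TS}_X(G)$.
   Context: All graphs are finite and simple. A graph parameter $X$ is a vertex parameter defined by property $x$ if either for every graph $G$, $X(G)=\max\{|B|: B\subseteq V(G),\ B \text{ has property } x \text{ in } G\}$, or for every graph $G$, $X(G)=\min\{|B|: B\subseteq V(G),\ B \text{ has property } x \text{ in } G\}$. $X$ is coverable if for every graph $G$ and every $v\in V(G)$, whenever $B$ has property $x$ in $G-v$, the set $B\cup\{v\}$ has property $x$ in $G$. The token exchange graph $\mathcal{TE}_X(G)$ has vertex set $\{S\subseteq V(G): |S|=X(G),\ S\text{ has property } x \text{ in } G\}$, with $S_1S_2$ an edge iff there exist $v_1\in S_1\setminus S_2$, $v_2\in S_2\setminus S_1$ with $S_1\setminus\{v_1\}=S_2\setminus\{v_2\}$. The token sliding graph $\mathcal{TS}_X(G)$ has the same vertex set, with $S_1S_2$ an edge iff such $v_1,v_2$ exist and $v_1v_2\in E(G)$. -}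

module Defs where

open import Data.Nat using (ℕ; suc; _≤_; _≥_)
open import Data.Bool using (Bool; true; false)
open import Data.Fin using (Fin; punchIn)
open import Data.Fin.Subset using (Subset; _∈_; _∉_; _-_; ∣_∣)
open import Data.Vec using (insertAt)
open import Data.Product using (Σ; ∃; _×_)
open import Relation.Binary.PropositionalEquality using (_≡_)

record Graph (n : ℕ) : Set where
  field
    adj  : Fin n → Fin n → Bool
    sym  : ∀ i j → adj i j ≡ adj j i
    irr  : ∀ i → adj i i ≡ false
open Graph public

Edge : ∀ {n} → Graph n → Fin n → Fin n → Set
Edge G u w = adj G u w ≡ true

_─v_ : ∀ {n} → Graph (suc n) → Fin (suc n) → Graph n
adj (G ─v v) i j = adj G (punchIn v i) (punchIn v j)
sym (G ─v v) i j = sym G (punchIn v i) (punchIn v j)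
irr (G ─v v) i   = irr G (punchIn v i)

-- For B ⊆ V(G - v), the set B ∪ {v} ⊆ V(G) (B transported along punchIn v).
addVertex : ∀ {n} → Fin (suc n) → Subset n → Subset (suc n)
addVertex v B = insertAt B v true

Property : Set₁
Property = ∀ {n} → Graph n → Subset n → Set

data Kind : Set where
  maxKind minKind : Kind

IsExtremal : Kind → Property → ∀ {n} → Graph n → ℕ → Set
IsExtremal maxKind x G k =
  (∃ λ B → x G B × ∣ B ∣ ≡ k) × (∀ B → x G B → ∣ B ∣ ≤ k)
IsExtremal minKind x G k =
  (∃ λ B → x G B × ∣ B ∣ ≡ k) × (∀ B → x G B → ∣ B ∣ ≥ k)

DefinedBy : (∀ {n} → Graph n → ℕ) → Kind → Property → Set
DefinedBy X kd x = ∀ {n} (G : Graph n) → IsExtremal kd x G (X G)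

Coverable : Property → Set
Coverable x = ∀ {n} (G : Graph (suc n)) (v : Fin (suc n)) (B : Subset n) →
  x (G ─v v) B → x G (addVertex v B)

-- Token exchange / token sliding graphs, with vertex set a predicate on Subset n.
TEVertex : (∀ {n} → Graph n → ℕ) → Property → ∀ {n} → Graph n → Subset n → Set
TEVertex X x G S = ∣ S ∣ ≡ X G × x G S

TEAdj : ∀ {n} → Subset n → Subset n → Set
TEAdj S₁ S₂ = Σ _ λ v₁ → Σ _ λ v₂ →
  v₁ ∈ S₁ × v₁ ∉ S₂ × v₂ ∈ S₂ × v₂ ∉ S₁ × (S₁ - v₁) ≡ (S₂ - v₂)

TSAdj : ∀ {n} → Graph n → Subset n → Subset n → Set
TSAdj G S₁ S₂ = Σ _ λ v₁ → Σ _ λ v₂ →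
  v₁ ∈ S₁ × v₁ ∉ S₂ × v₂ ∈ S₂ × v₂ ∉ S₁ × (S₁ - v₁) ≡ (S₂ - v₂) × Edge G v₁ v₂

-- The graph (V₁, E₁) on Subset m is isomorphic to a subgraph of (V₂, E₂) on
-- Subset n: an injective map of vertices preserving adjacency.
EmbedsInto : ∀ {m n} →
  (V₁ : Subset m → Set) (E₁ : Subset m → Subset m → Set) →
  (V₂ : Subset n → Set) (E₂ : Subset n → Subset n → Set) → Set
EmbedsInto V₁ E₁ V₂ E₂ = Σ (_ → _) λ f →
  (∀ S → V₁ S → V₂ (f S)) ×
  (∀ S T → V₁ S → V₁ T → f S ≡ f T → S ≡ T) ×
  (∀ S T → V₁ S → V₁ T → E₁ S T → E₂ (f S) (f T))

module Submission where

open import Defs hiding (sym)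
open import Data.Nat using (ℕ; suc)
open import Data.Fin using (Fin; zero; suc; punchIn)
open import Data.Fin.Subset using (Subset; _∈_; _∉_; _-_; ∣_∣; inside; outside)
open import Data.Fin.Subset.Properties using (p─⊥≡p)
open import Data.Product using (_×_; _,_)
open import Data.Vec using (Vec; _∷_; insertAt; removeAt; _[_]=_)
open import Data.Vec.Properties using (insertAt-punchIn; removeAt-insertAt; []=⇒lookup; lookup⇒[]=)
open import Relation.Binary.PropositionalEquality
  using (_≡_; refl; cong; sym; trans; module ≡-Reasoning)

-- Adding the vertex v is the map B ↦ B ∪ {v}.  Coverability and
-- X(G) = X(G - v) + 1 make it send minimum/maximum X-sets of G - v to
-- X-sets of G; it is injective because v can be removed again, and it
-- preserves token moves because the moved tokens are just renamed by punchIn v.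

module _ {a} {A : Set a} {n : ℕ} where

  insertAt-[]=⁺ : ∀ (xs : Vec A n) i y j {x} → xs [ j ]= x → insertAt xs i y [ punchIn i j ]= x
  insertAt-[]=⁺ xs i y j xs[j]=x =
    lookup⇒[]= (punchIn i j) _ (trans (insertAt-punchIn xs i y j) ([]=⇒lookup xs[j]=x))

  insertAt-[]=⁻ : ∀ (xs : Vec A n) i y j {x} → insertAt xs i y [ punchIn i j ]= x → xs [ j ]= x
  insertAt-[]=⁻ xs i y j ins[j]=x =
    lookup⇒[]= j xs (trans (sym (insertAt-punchIn xs i y j)) ([]=⇒lookup ins[j]=x))

  insertAt-injective : ∀ (xs ys : Vec A n) i y → insertAt xs i y ≡ insertAt ys i y → xs ≡ ys
  insertAt-injective xs ys i y eq = begin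
    xs                           ≡⟨ sym (removeAt-insertAt xs i y) ⟩
    removeAt (insertAt xs i y) i ≡⟨ cong (λ zs → removeAt zs i) eq ⟩
    removeAt (insertAt ys i y) i ≡⟨ removeAt-insertAt ys i y ⟩
    ys                           ∎
    where open ≡-Reasoning

∣insertAt-inside∣ : ∀ {n} (p : Subset n) i → ∣ insertAt p i inside ∣ ≡ suc ∣ p ∣
∣insertAt-inside∣ p             zero    = refl
∣insertAt-inside∣ (inside  ∷ p) (suc i) = cong suc (∣insertAt-inside∣ p i)
∣insertAt-inside∣ (outside ∷ p) (suc i) = ∣insertAt-inside∣ p i

insertAt-─-punchIn : ∀ {n} (p : Subset n) i b j → insertAt p i b - punchIn i j ≡ insertAt (p - j) i b
insertAt-─-punchIn p       zero    b j       = refl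
insertAt-─-punchIn (x ∷ p) (suc i) b zero    =
  cong (outside ∷_) (trans (p─⊥≡p (insertAt p i b)) (cong (λ q → insertAt q i b) (sym (p─⊥≡p p))))
insertAt-─-punchIn (x ∷ p) (suc i) b (suc j) = cong (x ∷_) (insertAt-─-punchIn p i b j)

addVertex-∈ : ∀ {n} (v : Fin (suc n)) S {j} → j ∈ S → punchIn v j ∈ addVertex v S
addVertex-∈ v S {j} = insertAt-[]=⁺ S v inside j

addVertex-∉ : ∀ {n} (v : Fin (suc n)) S {j} → j ∉ S → punchIn v j ∉ addVertex v S
addVertex-∉ v S {j} j∉S j∈S+v = j∉S (insertAt-[]=⁻ S v inside j j∈S+v)

addVertex-injective : ∀ {n} (v : Fin (suc n)) S T → addVertex v S ≡ addVertex v T → S ≡ T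
addVertex-injective v S T = insertAt-injective S T v inside

Exchange : ∀ {n} → Subset n → Subset n → Fin n → Fin n → Set
Exchange S₁ S₂ v₁ v₂ = v₁ ∈ S₁ × v₁ ∉ S₂ × v₂ ∈ S₂ × v₂ ∉ S₁ × (S₁ - v₁) ≡ (S₂ - v₂)

addVertex-exchange : ∀ {n} (v : Fin (suc n)) {S₁ S₂ v₁ v₂} → Exchange S₁ S₂ v₁ v₂ →
  Exchange (addVertex v S₁) (addVertex v S₂) (punchIn v v₁) (punchIn v v₂)
addVertex-exchange v {S₁} {S₂} {v₁} {v₂} (v₁∈S₁ , v₁∉S₂ , v₂∈S₂ , v₂∉S₁ , S₁-v₁≡S₂-v₂) =
  addVertex-∈ v S₁ v₁∈S₁ , addVertex-∉ v S₂ v₁∉S₂ ,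
  addVertex-∈ v S₂ v₂∈S₂ , addVertex-∉ v S₁ v₂∉S₁ ,
  (begin
    addVertex v S₁ - punchIn v v₁ ≡⟨ insertAt-─-punchIn S₁ v inside v₁ ⟩
    addVertex v (S₁ - v₁)         ≡⟨ cong (addVertex v) S₁-v₁≡S₂-v₂ ⟩
    addVertex v (S₂ - v₂)         ≡⟨ sym (insertAt-─-punchIn S₂ v inside v₂) ⟩
    addVertex v S₂ - punchIn v v₂ ∎)
  where open ≡-Reasoning

addVertex-TEAdj : ∀ {n} (v : Fin (suc n)) {S T} → TEAdj S T → TEAdj (addVertex v S) (addVertex v T)
addVertex-TEAdj v (v₁ , v₂ , exchange) = punchIn v v₁ , punchIn v v₂ , addVertex-exchange v exchange

addVertex-TSAdj : ∀ {n} (G : Graph (suc n)) (v : Fin (suc n)) {S T} →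
  TSAdj (G ─v v) S T → TSAdj G (addVertex v S) (addVertex v T)
addVertex-TSAdj G v (v₁ , v₂ , v₁∈S , v₁∉T , v₂∈T , v₂∉S , S-v₁≡T-v₂ , v₁v₂∈E)
  with addVertex-exchange v (v₁∈S , v₁∉T , v₂∈T , v₂∉S , S-v₁≡T-v₂)
... | v₁′∈S′ , v₁′∉T′ , v₂′∈T′ , v₂′∉S′ , S′-v₁′≡T′-v₂′ =
  punchIn v v₁ , punchIn v v₂ , v₁′∈S′ , v₁′∉T′ , v₂′∈T′ , v₂′∉S′ , S′-v₁′≡T′-v₂′ , v₁v₂∈E

addVertex-TEVertex : (X : ∀ {n} → Graph n → ℕ) (x : Property) → Coverable x →
  ∀ {n} (G : Graph (suc n)) (v : Fin (suc n)) → X G ≡ suc (X (G ─v v)) →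
  ∀ S → TEVertex X x (G ─v v) S → TEVertex X x G (addVertex v S)
addVertex-TEVertex X x covers G v X-step S (∣S∣≡X , xS) =
  (begin
    ∣ addVertex v S ∣ ≡⟨ ∣insertAt-inside∣ S v ⟩
    suc ∣ S ∣         ≡⟨ cong suc ∣S∣≡X ⟩
    suc (X (G ─v v))  ≡⟨ sym X-step ⟩
    X G               ∎) ,
  covers G v S xS
  where open ≡-Reasoning

addVertex-embeds : (X : ∀ {n} → Graph n → ℕ) (x : Property) → Coverable x →
  ∀ {n} (G : Graph (suc n)) (v : Fin (suc n)) → X G ≡ suc (X (G ─v v)) →
  {E₁ : Subset n → Subset n → Set} {E₂ : Subset (suc n) → Subset (suc n) → Set} →
  (∀ {S T} → E₁ S T → E₂ (addVertex v S) (addVertex v T)) →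
  EmbedsInto (TEVertex X x (G ─v v)) E₁ (TEVertex X x G) E₂
addVertex-embeds X x covers G v X-step preserves-E =
  addVertex v , addVertex-TEVertex X x covers G v X-step ,
  (λ S T _ _ → addVertex-injective v S T) ,
  (λ _ _ _ _ → preserves-E)

mainTheorem3 : (X : ∀ {n} → Graph n → ℕ) (kd : Kind) (x : Property) →
    DefinedBy X kd x → Coverable x →
    ∀ {n} (G : Graph (suc n)) (v : Fin (suc n)) → X G ≡ suc (X (G ─v v)) →
    EmbedsInto (TEVertex X x (G ─v v)) TEAdj (TEVertex X x G) TEAdj
    × EmbedsInto (TEVertex X x (G ─v v)) (TSAdj (G ─v v)) (TEVertex X x G) (TSAdj G)
mainTheorem3 X _ x _ covers G v X-step =
  addVertex-embeds X x covers G v X-step {E₂ = TEAdj} (addVertex-TEAdj v) ,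
  addVertex-embeds X x covers G v X-step {E₂ = TSAdj G} (addVertex-TSAdj G v)
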